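{- Let $n=ap+1$, where $a$ is a positive integer and $p$ is an odd prime. If $p\mid\varphi(n)$, then there exist integers $s$ and $t$ such that $tp+1$ is prime and $n=(sp+1)(tp+1)$.
   Context: $\varphi$ denotes Euler's totient function. -}

module Defs where

open import Data.Nat using (ℕ; suc; _≟_)
open import Data.Nat.GCD using (gcd)
open import Data.List using (List; length; filter; map)
open import Data.List.Base using (upTo)

φ : ℕ → ℕ
φ n = length (filter (λ k → gcd k n ≟ 1) (map suc (upTo n)))

{-# OPTIONS --safe #-}
-- For a prime q, φ (q m) = q φ m if q ∣ m and (q − 1) φ m otherwise; both follow from counting
-- the residues in [1, q m] coprime to m.  Walking along the prime factorisation of n, a prime
-- p ∣ φ n must therefore equal a prime factor q of n or divide q − 1.  As n = a p + 1, p ∤ n,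
-- so q ≡ 1 (mod p), and then n ≡ 1 (mod p) forces the cofactor n / q ≡ 1 (mod p) as well.
module Submission where

module Counting where

  open import Data.Bool using (Bool; true; false; if_then_else_; _∧_; not)
  open import Data.Bool.Properties using (∧-zeroʳ; ∧-identityʳ)
  open import Data.List using (length; filter; applyUpTo)
  open import Data.Nat
  open import Data.Nat.Divisibility using (_∣_; _∣?_; m∣m*n; ∣m+n∣m⇒∣n; ∣⇒≤)
  open import Data.Nat.Properties
  open import Function using (_∘_)
  open import Relation.Nullary using (¬_; does)
  open import Relation.Nullary.Decidable using (dec-true; dec-false)
  open import Relation.Unary using (Pred; Decidable)
  open import Relation.Binary.PropositionalEquality
  open ≡-Reasoning

  count : (ℕ → Bool) → ℕ → ℕ → ℕ
  count f b zero    = 0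
  count f b (suc L) = (if f b then 1 else 0) + count f (suc b) L

  length-filter-applyUpTo : ∀ {ℓ} {P : Pred ℕ ℓ} (P? : Decidable P) {h : ℕ → ℕ} {b : ℕ} →
    (∀ i → h i ≡ b + i) → ∀ L → length (filter P? (applyUpTo h L)) ≡ count (does ∘ P?) b L
  length-filter-applyUpTo P? h≗b+ zero = refl
  length-filter-applyUpTo P? {h} {b} h≗b+ (suc L) rewrite h≗b+ 0 | +-identityʳ b
    with does (P? b) | length-filter-applyUpTo P? {h ∘ suc} {suc b} (λ i → trans (h≗b+ (suc i)) (+-suc b i)) L
  ... | true  | ih = cong suc ih
  ... | false | ih = ih

  count-+ : ∀ f b L₁ L₂ → count f b (L₁ + L₂) ≡ count f b L₁ + count f (b + L₁) L₂
  count-+ f b zero L₂ rewrite +-identityʳ b = refl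
  count-+ f b (suc L₁) L₂ rewrite count-+ f (suc b) L₁ L₂ | +-suc b L₁ =
    sym (+-assoc (if f b then 1 else 0) _ _)

  count-cong : ∀ {f g} → (∀ k → f k ≡ g k) → ∀ b L → count f b L ≡ count g b L
  count-cong f≗g b zero    = refl
  count-cong f≗g b (suc L) rewrite f≗g b = cong (_ +_) (count-cong f≗g (suc b) L)

  count-none : ∀ f b L → (∀ i → i < L → f (b + i) ≡ false) → count f b L ≡ 0
  count-none f b zero    none = refl
  count-none f b (suc L) none rewrite subst (λ k → f k ≡ false) (+-identityʳ b) (none 0 z<s) =
    count-none f (suc b) L (λ i i<L → subst (λ k → f k ≡ false) (+-suc b i) (none (suc i) (s<s i<L)))

  count-partition : ∀ (f g : ℕ → Bool) b L →
    count f b L ≡ count (λ k → f k ∧ g k) b L + count (λ k → f k ∧ not (g k)) b L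
  count-partition f g b zero = refl
  count-partition f g b (suc L) with f b | g b | count-partition f g (suc b) L
  ... | true  | true  | ih = cong suc ih
  ... | true  | false | ih = trans (cong suc ih) (sym (+-suc _ _))
  ... | false | _     | ih = ih

  count-shift-period : ∀ f m → (∀ k → f (m + k) ≡ f k) → ∀ b L → count f (m + b) L ≡ count f b L
  count-shift-period f m periodic b zero = refl
  count-shift-period f m periodic b (suc L) rewrite periodic b | sym (+-suc m b) =
    cong (_ +_) (count-shift-period f m periodic (suc b) L)

  count-periods : ∀ f m → (∀ k → f (m + k) ≡ f k) → ∀ b q → count f b (q * m) ≡ q * count f b m
  count-periods f m periodic b zero = refl
  count-periods f m periodic b (suc q) = begin
    count f b (m + q * m)                 ≡⟨ count-+ f b m (q * m) ⟩
    count f b m + count f (b + m) (q * m) ≡⟨ cong (λ c → count f b m + count f c (q * m)) (+-comm b m) ⟩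
    count f b m + count f (m + b) (q * m) ≡⟨ cong (count f b m +_) (count-shift-period f m periodic b (q * m)) ⟩
    count f b m + count f b (q * m)       ≡⟨ cong (count f b m +_) (count-periods f m periodic b q) ⟩
    count f b m + q * count f b m         ∎

  -- The only multiple of q in (q m, q (m + 1)] is q (m + 1).
  count-multiples-block : ∀ f q .{{_ : NonZero q}} m →
    count (λ k → f k ∧ does (q ∣? k)) (suc (q * m)) q ≡ count (f ∘ (q *_)) (suc m) 1
  count-multiples-block f q@(suc q′) m = begin
    count F b (suc q′)                  ≡⟨ cong (count F b) (+-comm 1 q′) ⟩
    count F b (q′ + 1)                  ≡⟨ count-+ F b q′ 1 ⟩
    count F b q′ + count F (b + q′) 1   ≡⟨ cong₂ _+_ (count-none F b q′ non-multiple) (cong (λ k → count F k 1) b+q′≡q*[1+m]) ⟩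
    count F (q * suc m) 1               ≡⟨ cong (λ x → (if x then 1 else 0) + 0) multiple ⟩
    count (f ∘ (q *_)) (suc m) 1        ∎
    where
    F : ℕ → Bool
    F k = f k ∧ does (q ∣? k)
    b : ℕ
    b = suc (q * m)

    non-multiple : ∀ i → i < q′ → F (b + i) ≡ false
    non-multiple i i<q′ = trans (cong (f (b + i) ∧_) (dec-false (q ∣? (b + i)) q∤b+i)) (∧-zeroʳ _)
      where
      q∤b+i : ¬ q ∣ b + i
      q∤b+i q∣b+i = <⇒≱ (s<s i<q′) (∣⇒≤ (∣m+n∣m⇒∣n (subst (q ∣_) (sym (+-suc (q * m) i)) q∣b+i) (m∣m*n m)))

    b+q′≡q*[1+m] : b + q′ ≡ q * suc m
    b+q′≡q*[1+m] = trans (cong suc (+-comm (q * m) q′)) (sym (*-suc q m))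

    multiple : F (q * suc m) ≡ f (q * suc m)
    multiple = trans (cong (f (q * suc m) ∧_) (dec-true (q ∣? (q * suc m)) (m∣m*n (suc m)))) (∧-identityʳ _)

  count-multiples : ∀ f q .{{_ : NonZero q}} m →
    count (λ k → f k ∧ does (q ∣? k)) 1 (q * m) ≡ count (f ∘ (q *_)) 1 m
  count-multiples f q zero rewrite *-zeroʳ q = refl
  count-multiples f q (suc m) = begin
    count F 1 (q * suc m)                     ≡⟨ cong (count F 1) (trans (*-suc q m) (+-comm q (q * m))) ⟩
    count F 1 (q * m + q)                     ≡⟨ count-+ F 1 (q * m) q ⟩
    count F 1 (q * m) + count F (suc (q * m)) q ≡⟨ cong₂ _+_ (count-multiples f q m) (count-multiples-block f q m) ⟩
    count G 1 m + count G (suc m) 1           ≡⟨ count-+ G 1 m 1 ⟨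
    count G 1 (m + 1)                         ≡⟨ cong (count G 1) (+-comm m 1) ⟩
    count G 1 (suc m)                         ∎
    where
    F G : ℕ → Bool
    F k = f k ∧ does (q ∣? k)
    G = f ∘ (q *_)

module Totient where

  open import Defs
  open Counting
  open import Data.Bool using (Bool; false; _∧_; not)
  open import Data.Bool.Properties using (∧-zeroʳ; ∧-identityʳ)
  open import Data.Empty using (⊥-elim)
  open import Data.List using ([]; _∷_)
  open import Data.List.Properties using (map-upTo)
  open import Data.List.Relation.Unary.All using (All; []; _∷_)
  open import Data.Nat
  open import Data.Nat.Coprimality using (Coprime; coprime?; coprime-divisor)
  open import Data.Nat.Divisibility
  open import Data.Nat.GCD using (gcd)
  open import Data.Nat.ListAction using (product)
  open import Data.Nat.Primality using (Prime; prime⇒irreducible; prime⇒nonTrivial; euclidsLemma)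
  open import Data.Nat.Primality.Factorisation using (factorise; PrimeFactorisation)
  open import Data.Nat.Properties
  open import Data.Nat.Tactic.RingSolver using (solve-∀)
  open import Data.Product using (∃; _×_; _,_)
  open import Data.Sum using (_⊎_; inj₁; inj₂)
  open import Function using (_⇔_; mk⇔; case_of_)
  open import Relation.Nullary using (¬_; does; yes; no)
  open import Relation.Nullary.Decidable using (dec-false; does-⇔)
  open import Relation.Binary.PropositionalEquality
  open ≡-Reasoning

  prime⇒≢1 : ∀ {q} → Prime q → q ≢ 1
  prime⇒≢1 q-prime = nonTrivial⇒≢1 {{prime⇒nonTrivial q-prime}}

  prime∤⇒coprime : ∀ {q d} → Prime q → ¬ q ∣ d → Coprime d q
  prime∤⇒coprime q-prime q∤d (e∣d , e∣q) with prime⇒irreducible q-prime e∣q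
  ... | inj₁ e≡1  = e≡1
  ... | inj₂ refl = ⊥-elim (q∤d e∣d)

  prime∣prime⇒≡ : ∀ {p q} → Prime p → Prime q → p ∣ q → p ≡ q
  prime∣prime⇒≡ p-prime q-prime p∣q with prime⇒irreducible q-prime p∣q
  ... | inj₁ refl = ⊥-elim (prime⇒≢1 p-prime refl)
  ... | inj₂ p≡q  = p≡q

  coprimeTo : ℕ → ℕ → Bool
  coprimeTo n k = does (coprime? k n)

  φ≡count-coprimeTo : ∀ n → φ n ≡ count (coprimeTo n) 1 n
  φ≡count-coprimeTo n rewrite map-upTo suc n = length-filter-applyUpTo (λ k → gcd k n ≟ 1) (λ _ → refl) n

  coprimeTo-⇔ : ∀ {n k n′ k′} → Coprime k n ⇔ Coprime k′ n′ → coprimeTo n k ≡ coprimeTo n′ k′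
  coprimeTo-⇔ {n} {k} {n′} {k′} k⊥n⇔k′⊥n′ = does-⇔ k⊥n⇔k′⊥n′ (coprime? k n) (coprime? k′ n′)

  coprimeTo-+ : ∀ m k → coprimeTo m (m + k) ≡ coprimeTo m k
  coprimeTo-+ m k = coprimeTo-⇔ {m} {m + k} {m} {k} (mk⇔
    (λ c {_} (d∣k , d∣m) → c (∣m∣n⇒∣m+n d∣m d∣k , d∣m))
    (λ c {_} (d∣m+k , d∣m) → c (∣m+n∣m⇒∣n d∣m+k d∣m , d∣m)))

  coprimeTo-prime* : ∀ {q} m k → Prime q → coprimeTo (q * m) k ≡ coprimeTo m k ∧ not (does (q ∣? k))
  coprimeTo-prime* {q} m k q-prime with q ∣? k
  ... | yes q∣k = trans (dec-false (coprime? k (q * m)) (λ c → prime⇒≢1 q-prime (c (q∣k , m∣m*n m)))) (sym (∧-zeroʳ _))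
  ... | no  q∤k = trans (coprimeTo-⇔ {q * m} {k} {m} {k} (mk⇔
    (λ c {_} (d∣k , d∣m) → c (d∣k , ∣-trans d∣m (n∣m*n q)))
    (λ c {_} (d∣k , d∣qm) → c (d∣k , coprime-divisor (prime∤⇒coprime q-prime (λ q∣d → q∤k (∣-trans q∣d d∣k))) d∣qm))))
    (sym (∧-identityʳ _))

  coprimeTo-*-prime∤ : ∀ {q} m i → Prime q → ¬ q ∣ m → coprimeTo m (q * i) ≡ coprimeTo m i
  coprimeTo-*-prime∤ {q} m i q-prime q∤m = coprimeTo-⇔ {m} {q * i} {m} {i} (mk⇔
    (λ c {_} (d∣i , d∣m) → c (∣-trans d∣i (n∣m*n q) , d∣m))
    (λ c {_} (d∣qi , d∣m) → c (coprime-divisor (prime∤⇒coprime q-prime (λ q∣d → q∤m (∣-trans q∣d d∣m))) d∣qi , d∣m)))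

  coprimeTo-*-prime∣ : ∀ {q} m i → Prime q → q ∣ m → coprimeTo m (q * i) ≡ false
  coprimeTo-*-prime∣ {q} m i q-prime q∣m = dec-false (coprime? (q * i) m) (λ c → prime⇒≢1 q-prime (c (m∣m*n i , q∣m)))

  -- Coprimality to m is m-periodic, so q φ m counts the k ∈ [1, q m] coprime to m; those
  -- not divisible by q are the ones coprime to q m, the others are q i with q i coprime to m.
  *-φ≡multiples+φ-* : ∀ {q} m → Prime q → q * φ m ≡ count (λ i → coprimeTo m (q * i)) 1 m + φ (q * m)
  *-φ≡multiples+φ-* {q@(suc _)} m q-prime = begin
    q * φ m
      ≡⟨ cong (q *_) (φ≡count-coprimeTo m) ⟩
    q * count (coprimeTo m) 1 m
      ≡⟨ count-periods (coprimeTo m) m (coprimeTo-+ m) 1 q ⟨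
    count (coprimeTo m) 1 (q * m)
      ≡⟨ count-partition (coprimeTo m) (λ k → does (q ∣? k)) 1 (q * m) ⟩
    count (λ k → coprimeTo m k ∧ does (q ∣? k)) 1 (q * m) + count (λ k → coprimeTo m k ∧ not (does (q ∣? k))) 1 (q * m)
      ≡⟨ cong₂ _+_ (count-multiples (coprimeTo m) q m) (sym (count-cong (λ k → coprimeTo-prime* m k q-prime) 1 (q * m))) ⟩
    count (λ i → coprimeTo m (q * i)) 1 m + count (coprimeTo (q * m)) 1 (q * m)
      ≡⟨ cong (count (λ i → coprimeTo m (q * i)) 1 m +_) (φ≡count-coprimeTo (q * m)) ⟨
    count (λ i → coprimeTo m (q * i)) 1 m + φ (q * m)
      ∎

  φ-*-prime∣ : ∀ {q} m → Prime q → q ∣ m → φ (q * m) ≡ q * φ m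
  φ-*-prime∣ {q} m q-prime q∣m = sym (begin
    q * φ m                                           ≡⟨ *-φ≡multiples+φ-* m q-prime ⟩
    count (λ i → coprimeTo m (q * i)) 1 m + φ (q * m) ≡⟨ cong (_+ φ (q * m)) no-multiples ⟩
    φ (q * m)                                         ∎)
    where
    no-multiples : count (λ i → coprimeTo m (q * i)) 1 m ≡ 0
    no-multiples = count-none _ 1 m (λ i _ → coprimeTo-*-prime∣ m (1 + i) q-prime q∣m)

  φ-*-prime∤ : ∀ {q} m → Prime q → ¬ q ∣ m → φ (q * m) ≡ (q ∸ 1) * φ m
  φ-*-prime∤ {q@(suc q′)} m q-prime q∤m = +-cancelˡ-≡ (φ m) _ _ (sym (begin
    q * φ m                                           ≡⟨ *-φ≡multiples+φ-* m q-prime ⟩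
    count (λ i → coprimeTo m (q * i)) 1 m + φ (q * m) ≡⟨ cong (_+ φ (q * m)) multiples ⟩
    φ m + φ (q * m)                                   ∎))
    where
    multiples : count (λ i → coprimeTo m (q * i)) 1 m ≡ φ m
    multiples = trans (count-cong (λ i → coprimeTo-*-prime∤ m i q-prime q∤m) 1 m) (sym (φ≡count-coprimeTo m))

  PrimeFactor : (ℕ → Set) → ℕ → Set
  PrimeFactor P n = ∃ λ r → Prime r × r ∣ n × P r

  PrimeFactor-∣ : ∀ {P m n} → m ∣ n → PrimeFactor P m → PrimeFactor P n
  PrimeFactor-∣ m∣n (r , r-prime , r∣m , Pr) = r , r-prime , ∣-trans r∣m m∣n , Pr

  prime∣φ-product⇒prime-factor : ∀ {p} → Prime p → ∀ {l} → All Prime l → p ∣ φ (product l) →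
    PrimeFactor (λ q → p ≡ q ⊎ p ∣ q ∸ 1) (product l)
  prime∣φ-product⇒prime-factor p-prime [] p∣φ1 = ⊥-elim (prime⇒≢1 p-prime (∣1⇒≡1 p∣φ1))
  prime∣φ-product⇒prime-factor {p} p-prime {q ∷ l} (q-prime ∷ l-prime) p∣φ with q ∣? product l
  ... | yes q∣m = case euclidsLemma q (φ (product l)) p-prime (subst (p ∣_) (φ-*-prime∣ (product l) q-prime q∣m) p∣φ) of λ where
    (inj₁ p∣q)  → q , q-prime , m∣m*n (product l) , inj₁ (prime∣prime⇒≡ p-prime q-prime p∣q)
    (inj₂ p∣φm) → PrimeFactor-∣ (n∣m*n q) (prime∣φ-product⇒prime-factor p-prime l-prime p∣φm)
  ... | no q∤m = case euclidsLemma (q ∸ 1) (φ (product l)) p-prime (subst (p ∣_) (φ-*-prime∤ (product l) q-prime q∤m) p∣φ) of λ where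
    (inj₁ p∣q-1) → q , q-prime , m∣m*n (product l) , inj₂ p∣q-1
    (inj₂ p∣φm)  → PrimeFactor-∣ (n∣m*n q) (prime∣φ-product⇒prime-factor p-prime l-prime p∣φm)

  prime∣φ⇒prime-factor : ∀ {p} → Prime p → ∀ n .{{_ : NonZero n}} → p ∣ φ n →
    PrimeFactor (λ q → p ≡ q ⊎ p ∣ q ∸ 1) n
  prime∣φ⇒prime-factor {p} p-prime n p∣φn = PrimeFactor-∣ (∣-reflexive (sym isFactorisation))
    (prime∣φ-product⇒prime-factor p-prime factorsPrime (subst (λ m → p ∣ φ m) isFactorisation p∣φn))
    where open PrimeFactorisation (factorise n)

  ≡1-mod-cofactor : ∀ a p r t → a * p + 1 ≡ r * (t * p + 1) → ∃ λ s → r ≡ s * p + 1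
  ≡1-mod-cofactor a p zero     t ap+1≡0 = ⊥-elim (0≢1+n (trans (sym ap+1≡0) (+-comm (a * p) 1)))
  ≡1-mod-cofactor a p (suc r′) t ap+1≡r[tp+1] = s , trans (cong suc r′≡sp) (+-comm 1 (s * p))
    where
    expand : ∀ r t p → suc r * (t * p + 1) ≡ suc r * t * p + r + 1
    expand = solve-∀

    ap≡[1+r′]tp+r′ : a * p ≡ suc r′ * t * p + r′
    ap≡[1+r′]tp+r′ = +-cancelʳ-≡ 1 _ _ (trans ap+1≡r[tp+1] (expand r′ t p))

    p∣r′ : p ∣ r′
    p∣r′ = ∣m+n∣m⇒∣n (subst (p ∣_) ap≡[1+r′]tp+r′ (n∣m*n a)) (n∣m*n (suc r′ * t))

    s : ℕ
    s = quotient p∣r′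

    r′≡sp : r′ ≡ s * p
    r′≡sp = _∣_.equality p∣r′

  ≡1-mod-prime-factor : ∀ a {p} → Prime p → p ∣ φ (a * p + 1) →
    ∃ λ s → ∃ λ t → Prime (t * p + 1) × a * p + 1 ≡ (s * p + 1) * (t * p + 1)
  ≡1-mod-prime-factor a {p} p-prime p∣φn
    with prime∣φ⇒prime-factor p-prime (a * p + 1) {{subst NonZero (+-comm 1 (a * p)) _}} p∣φn
  ... | q , q-prime , q∣n , inj₁ refl = ⊥-elim (p∤n q∣n)
    where
    p∤n : ¬ p ∣ a * p + 1
    p∤n p∣n = prime⇒≢1 p-prime (∣1⇒≡1 (∣m+n∣m⇒∣n p∣n (n∣m*n a)))
  ... | suc q′ , q-prime , divides r n≡rq , inj₂ (divides t q′≡tp) =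
    let s , r≡sp+1 = ≡1-mod-cofactor a p r t n≡r[tp+1] in
    s , t , subst Prime q≡tp+1 q-prime , trans n≡r[tp+1] (cong (_* (t * p + 1)) r≡sp+1)
    where
    q≡tp+1 : suc q′ ≡ t * p + 1
    q≡tp+1 = trans (cong suc q′≡tp) (+-comm 1 (t * p))
    n≡r[tp+1] : a * p + 1 ≡ r * (t * p + 1)
    n≡r[tp+1] = trans n≡rq (cong (r *_) q≡tp+1)

open import Defs
open import Data.Nat using (ℕ) renaming (_+_ to _+ℕ_; _*_ to _*ℕ_; _≤_ to _≤ℕ_)
open import Data.Nat.Divisibility using (_∣_)
open import Data.Nat.Primality using (Prime)
open import Data.Integer using (ℤ; +_; _+_; _*_)
open import Data.Integer.Properties using (pos-+; pos-*)
open import Data.Product using (Σ; ∃₂; _×_; _,_)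
open import Relation.Binary.PropositionalEquality using (_≡_; _≢_; sym; trans; cong; cong₂)

+[m*n+1]≡+m*+n+1 : ∀ m n → + (m *ℕ n +ℕ 1) ≡ + m * + n + + 1
+[m*n+1]≡+m*+n+1 m n = trans (pos-+ (m *ℕ n) 1) (cong (_+ + 1) (pos-* m n))

lemma2p1 : (a p : ℕ) → 1 ≤ℕ a → Prime p → p ≢ 2 →
    p ∣ φ (a *ℕ p +ℕ 1) →
    ∃₂ λ (s t : ℤ) →
    (Σ ℕ λ q → (t * + p + + 1 ≡ + q) × Prime q) ×
    (+ (a *ℕ p +ℕ 1) ≡ (s * + p + + 1) * (t * + p + + 1))
lemma2p1 a p _ p-prime _ p∣φn =
  let s , t , tp+1-prime , n≡[sp+1][tp+1] = Totient.≡1-mod-prime-factor a p-prime p∣φn in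
  + s , + t ,
  (t *ℕ p +ℕ 1 , sym (+[m*n+1]≡+m*+n+1 t p) , tp+1-prime) ,
  trans (cong +_ n≡[sp+1][tp+1])
    (trans (pos-* (s *ℕ p +ℕ 1) (t *ℕ p +ℕ 1)) (cong₂ _*_ (+[m*n+1]≡+m*+n+1 s p) (+[m*n+1]≡+m*+n+1 t p)))
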